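{- Let $D$ be a minimal strong digraph, let $C_q$ be a directed cycle of length $q\ge 2$ contained in $D$, and let $D'$ be the digraph obtained from $D$ by deleting all arcs of $C_q$. Then no strong component of $D'$ contains two consecutive vertices of $C_q$. Consequently, for every strong component $S$ of $D'$ containing at least one vertex of $C_q$, the number $\lambda$ of vertices of $C_q$ in $S$ satisfies $1\le \lambda\le \lfloor q/2\rfloor$.
   Context: An arc $uv$ of a digraph is transitive if there is another directed $uv$-path not using the arc $uv$. A minimal strong digraph is a strongly connected digraph with no transitive arcs. A strong component is a maximal strongly connected subdigraph. Two vertices of $C_q$ are consecutive if they are joined by an arc of $C_q$. -}

module Defs where

open import Data.Nat using (ℕ; NonZero)
open import Data.Nat.DivMod using (_mod_)
open import Data.Fin using (Fin; toℕ)
open import Data.Fin.Subset using (Subset; _∈_; _⊆_; ∣_∣)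
open import Data.Vec using (tabulate; lookup)
open import Data.Product using (_×_; Σ)
open import Data.Empty using (⊥)
open import Relation.Nullary using (¬_)
open import Relation.Binary.PropositionalEquality using (_≡_)

record Digraph (n : ℕ) : Set₁ where
  field
    Arc      : Fin n → Fin n → Set
    loopless : ∀ v → ¬ Arc v v
open Digraph public

-- Directed walks (reachability) along an arc relation R.
-- (A directed u–v path exists iff a directed u–v walk exists.)
data Reach {n : ℕ} (R : Fin n → Fin n → Set) : Fin n → Fin n → Set where
  here : ∀ {u} → Reach R u u
  step : ∀ {u w v} → R u w → Reach R w v → Reach R u v

StronglyConnected : ∀ {n} → Digraph n → Set
StronglyConnected D = ∀ u v → Reach (Arc D) u v

WithoutArc : ∀ {n} → Digraph n → Fin n → Fin n → Fin n → Fin n → Set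
WithoutArc D u v x y = Arc D x y × ¬ ((x ≡ u) × (y ≡ v))

TransitiveArc : ∀ {n} → Digraph n → Fin n → Fin n → Set
TransitiveArc D u v = Arc D u v × Reach (WithoutArc D u v) u v

MinimalStrong : ∀ {n} → Digraph n → Set
MinimalStrong D = StronglyConnected D × (∀ u v → ¬ TransitiveArc D u v)

next : ∀ {q} .{{_ : NonZero q}} → Fin q → Fin q
next {q} i = ℕ.suc (toℕ i) mod q

record DirectedCycle {n : ℕ} (D : Digraph n) (q : ℕ) .{{_ : NonZero q}} : Set where
  field
    vtx       : Fin q → Fin n
    injective : ∀ i j → vtx i ≡ vtx j → i ≡ j
    arcs      : ∀ i → Arc D (vtx i) (vtx (next i))
open DirectedCycle public

CycleArc : ∀ {n q} .{{_ : NonZero q}} {D : Digraph n} → DirectedCycle D q → Fin n → Fin n → Set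
CycleArc {q = q} C x y = Σ (Fin q) λ i → (x ≡ vtx C i) × (y ≡ vtx C (next i))

DeleteCycle : ∀ {n q} .{{_ : NonZero q}} {D : Digraph n} → DirectedCycle D q → Digraph n
DeleteCycle {D = D} C = record
  { Arc      = λ x y → Arc D x y × ¬ CycleArc C x y
  ; loopless = λ v a → loopless D v (Data.Product.proj₁ a) }
  where import Data.Product

Induced : ∀ {n} → Digraph n → Subset n → Fin n → Fin n → Set
Induced D S x y = (x ∈ S) × (y ∈ S) × Arc D x y

StronglyConnectedSet : ∀ {n} → Digraph n → Subset n → Set
StronglyConnectedSet D S = ∀ x y → x ∈ S → y ∈ S → Reach (Induced D S) x y

StrongComponent : ∀ {n} → Digraph n → Subset n → Set
StrongComponent {n} D S =
  (Σ (Fin n) λ v → v ∈ S) × StronglyConnectedSet D S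
  × (∀ T → S ⊆ T → StronglyConnectedSet D T → T ⊆ S)

cycleCount : ∀ {n q} .{{_ : NonZero q}} {D : Digraph n} → DirectedCycle D q → Subset n → ℕ
cycleCount C S = ∣ tabulate (λ i → lookup S (vtx C i)) ∣

{-# OPTIONS --safe #-}
module Submission where

open import Defs
open import Data.Nat using (ℕ; NonZero; _≤_; _/_; _+_; _*_; _∸_; suc; z≤n; s≤s)
open import Data.Nat.Properties
  using (≤-trans; ≤-reflexive; *-comm; +-identityʳ; m≤o∸n⇒m+n≤o; module ≤-Reasoning)
open import Data.Nat.DivMod using (_%_; m*n/n≡m; /-monoˡ-≤; m<n⇒m%n≡m; n%n≡0)
open import Data.Fin using (Fin; zero; suc; toℕ; inject₁; fromℕ)
open import Data.Fin.Properties using (toℕ-injective; toℕ-inject₁; toℕ-fromℕ; toℕ-fromℕ<; toℕ<n)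
open import Data.Fin.Subset using (Subset; inside; outside; _∈_; _⊆_; ∁; ∣_∣)
open import Data.Fin.Subset.Properties
  using (x∉p⇒x∈∁p; p⊆q⇒∣p∣≤∣q∣; ∣∁p∣≡n∸∣p∣; ∣p∣≤n; x∈p⇒∣p-x∣<∣p∣)
open import Data.Vec using ([]; _∷_; _∷ʳ_; tabulate; lookup)
open import Data.Vec.Properties
  using (tabulate-cong; tabulate∘lookup; lookup∘tabulate; []=⇒lookup; lookup⇒[]=)
open import Data.Product using (_×_; Σ; _,_)
open import Function using (_∘_)
open import Relation.Nullary using (¬_)
open import Relation.Binary.PropositionalEquality using (_≡_; refl; sym; trans; cong; cong₂; module ≡-Reasoning)

-- If consecutive cycle vertices c i and c (i+1) lay in one strong component of
-- D', a walk from c i to c (i+1) inside it would avoid every cycle arc, so the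
-- arc c i → c (i+1) would be transitive. Hence the set P of indices i with
-- c i in a given component is disjoint from its preimage under the cyclic
-- successor; that preimage has the same size as P, so 2 ∣P∣ ≤ q.

Reach-map : ∀ {n} {R R′ : Fin n → Fin n → Set} →
            (∀ {x y} → R x y → R′ x y) → ∀ {u v} → Reach R u v → Reach R′ u v
Reach-map f here       = here
Reach-map f (step r w) = step (f r) (Reach-map f w)

consecutive∉stronglyConnected :
  ∀ {n q} .{{_ : NonZero q}} {D : Digraph n} → (∀ u v → ¬ TransitiveArc D u v) →
  (C : DirectedCycle D q) → ∀ {S} → StronglyConnectedSet (DeleteCycle C) S →
  ∀ i → ¬ (vtx C i ∈ S × vtx C (next i) ∈ S)
consecutive∉stronglyConnected {D = D} noTransitive C {S} connected i (ci∈S , ci+1∈S) =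
  noTransitive (vtx C i) (vtx C (next i))
    (arcs C i , Reach-map avoidsCycleArc (connected _ _ ci∈S ci+1∈S))
  where
  avoidsCycleArc : ∀ {x y} → Induced (DeleteCycle C) S x y →
                   WithoutArc D (vtx C i) (vtx C (next i)) x y
  avoidsCycleArc (_ , _ , xy , notCycleArc) =
    xy , λ (x≡ci , y≡ci+1) → notCycleArc (i , x≡ci , y≡ci+1)

next-inject₁ : ∀ {m} (i : Fin m) → next {suc m} (inject₁ i) ≡ suc i
next-inject₁ {m} i = toℕ-injective (begin
  toℕ (next (inject₁ i))         ≡⟨ toℕ-fromℕ< _ ⟩
  suc (toℕ (inject₁ i)) % suc m  ≡⟨ cong (λ k → suc k % suc m) (toℕ-inject₁ i) ⟩
  suc (toℕ i) % suc m            ≡⟨ m<n⇒m%n≡m (s≤s (toℕ<n i)) ⟩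
  suc (toℕ i)                    ∎)
  where open ≡-Reasoning

next-fromℕ : ∀ m → next {suc m} (fromℕ m) ≡ zero
next-fromℕ m = toℕ-injective (begin
  toℕ (next (fromℕ m))         ≡⟨ toℕ-fromℕ< _ ⟩
  suc (toℕ (fromℕ m)) % suc m  ≡⟨ cong (λ k → suc k % suc m) (toℕ-fromℕ m) ⟩
  suc m % suc m                ≡⟨ n%n≡0 (suc m) ⟩
  0                            ∎)
  where open ≡-Reasoning

tabulate-∷ʳ : ∀ {a} {A : Set a} {m} (f : Fin (suc m) → A) →
              tabulate f ≡ tabulate (f ∘ inject₁) ∷ʳ f (fromℕ m)
tabulate-∷ʳ {m = 0}     f = refl
tabulate-∷ʳ {m = suc m} f = cong (f zero ∷_) (tabulate-∷ʳ (f ∘ suc))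

tabulate-next : ∀ {a} {A : Set a} {m} (f : Fin (suc m) → A) →
                tabulate (f ∘ next) ≡ tabulate (f ∘ suc) ∷ʳ f zero
tabulate-next {m = m} f = begin
  tabulate (f ∘ next)                                   ≡⟨ tabulate-∷ʳ (f ∘ next) ⟩
  tabulate (f ∘ next ∘ inject₁) ∷ʳ f (next (fromℕ m))   ≡⟨ cong₂ _∷ʳ_ (tabulate-cong (cong f ∘ next-inject₁))
                                                                       (cong f (next-fromℕ m)) ⟩
  tabulate (f ∘ suc) ∷ʳ f zero                          ∎
  where open ≡-Reasoning

∣p∷ʳx∣≡∣x∷p∣ : ∀ {n} x (p : Subset n) → ∣ p ∷ʳ x ∣ ≡ ∣ x ∷ p ∣
∣p∷ʳx∣≡∣x∷p∣ outside []            = refl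
∣p∷ʳx∣≡∣x∷p∣ inside  []            = refl
∣p∷ʳx∣≡∣x∷p∣ outside (outside ∷ p) = ∣p∷ʳx∣≡∣x∷p∣ outside p
∣p∷ʳx∣≡∣x∷p∣ outside (inside  ∷ p) = cong suc (∣p∷ʳx∣≡∣x∷p∣ outside p)
∣p∷ʳx∣≡∣x∷p∣ inside  (outside ∷ p) = ∣p∷ʳx∣≡∣x∷p∣ inside p
∣p∷ʳx∣≡∣x∷p∣ inside  (inside  ∷ p) = cong suc (∣p∷ʳx∣≡∣x∷p∣ inside p)

preimage : ∀ {m n} → (Fin m → Fin n) → Subset n → Subset m
preimage g p = tabulate (λ i → lookup p (g i))

∈-preimage⁺ : ∀ {m n} {g : Fin m → Fin n} {p i} → g i ∈ p → i ∈ preimage g p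
∈-preimage⁺ {i = i} gi∈p = lookup⇒[]= i _ (trans (lookup∘tabulate _ i) ([]=⇒lookup gi∈p))

∈-preimage⁻ : ∀ {m n} {g : Fin m → Fin n} {p i} → i ∈ preimage g p → g i ∈ p
∈-preimage⁻ {g = g} {p} {i} i∈g⁻¹p = lookup⇒[]= (g i) p (trans (sym (lookup∘tabulate _ i)) ([]=⇒lookup i∈g⁻¹p))

∣preimage-next∣ : ∀ {q} .{{_ : NonZero q}} (p : Subset q) → ∣ preimage next p ∣ ≡ ∣ p ∣
∣preimage-next∣ {suc _} p@(x ∷ p′) = begin
  ∣ preimage next p ∣                 ≡⟨ cong ∣_∣ (tabulate-next (lookup p)) ⟩
  ∣ tabulate (lookup p′) ∷ʳ x ∣       ≡⟨ cong (λ r → ∣ r ∷ʳ x ∣) (tabulate∘lookup p′) ⟩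
  ∣ p′ ∷ʳ x ∣                         ≡⟨ ∣p∷ʳx∣≡∣x∷p∣ x p′ ⟩
  ∣ p ∣                               ∎
  where open ≡-Reasoning

no-consecutive⇒∣p∣+∣p∣≤q : ∀ {q} .{{_ : NonZero q}} (p : Subset q) →
                           (∀ i → ¬ (i ∈ p × next i ∈ p)) → ∣ p ∣ + ∣ p ∣ ≤ q
no-consecutive⇒∣p∣+∣p∣≤q {q} p separated = m≤o∸n⇒m+n≤o ∣ p ∣ (∣p∣≤n p) (begin
  ∣ p ∣                         ≤⟨ p⊆q⇒∣p∣≤∣q∣ p⊆∁preimage ⟩
  ∣ ∁ (preimage next p) ∣       ≡⟨ ∣∁p∣≡n∸∣p∣ (preimage next p) ⟩
  q ∸ ∣ preimage next p ∣       ≡⟨ cong (q ∸_) (∣preimage-next∣ p) ⟩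
  q ∸ ∣ p ∣                     ∎)
  where
  open ≤-Reasoning
  p⊆∁preimage : p ⊆ ∁ (preimage next p)
  p⊆∁preimage i∈p = x∉p⇒x∈∁p (λ i∈preimage → separated _ (i∈p , ∈-preimage⁻ i∈preimage))

x∈p⇒1≤∣p∣ : ∀ {n} {p : Subset n} {x} → x ∈ p → 1 ≤ ∣ p ∣
x∈p⇒1≤∣p∣ x∈p = ≤-trans (s≤s z≤n) (x∈p⇒∣p-x∣<∣p∣ x∈p)

m+m≤n⇒m≤n/2 : ∀ {m n} → m + m ≤ n → m ≤ n / 2
m+m≤n⇒m≤n/2 {m} {n} m+m≤n = begin
  m          ≡⟨ sym (m*n/n≡m m 2) ⟩
  m * 2 / 2  ≤⟨ /-monoˡ-≤ 2 (≤-trans (≤-reflexive m*2≡m+m) m+m≤n) ⟩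
  n / 2      ∎
  where
  open ≤-Reasoning
  m*2≡m+m : m * 2 ≡ m + m
  m*2≡m+m = trans (*-comm m 2) (cong (m +_) (+-identityʳ m))

lemma2 : ∀ {n : ℕ} (D : Digraph n) → MinimalStrong D →
    (q : ℕ) .{{_ : NonZero q}} → 2 ≤ q → (C : DirectedCycle D q) →
    (∀ (S : Subset n) → StrongComponent (DeleteCycle C) S →
       ∀ (i : Fin q) → ¬ ((vtx C i ∈ S) × (vtx C (next i) ∈ S)))
    × (∀ (S : Subset n) → StrongComponent (DeleteCycle C) S →
       (Σ (Fin q) λ i → vtx C i ∈ S) →
       (1 ≤ cycleCount C S) × (cycleCount C S ≤ q / 2))
lemma2 D (_ , noTransitive) q _ C = consecutive∉ , bounds
  where
  consecutive∉ : ∀ S → StrongComponent (DeleteCycle C) S →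
                 ∀ i → ¬ (vtx C i ∈ S × vtx C (next i) ∈ S)
  consecutive∉ S (_ , connected , _) = consecutive∉stronglyConnected noTransitive C connected

  bounds : ∀ S → StrongComponent (DeleteCycle C) S → (Σ (Fin q) λ i → vtx C i ∈ S) →
           (1 ≤ cycleCount C S) × (cycleCount C S ≤ q / 2)
  bounds S component (_ , ci∈S) =
    x∈p⇒1≤∣p∣ (∈-preimage⁺ {g = vtx C} ci∈S) ,
    m+m≤n⇒m≤n/2 (no-consecutive⇒∣p∣+∣p∣≤q (preimage (vtx C) S)
      λ i (i∈P , i+1∈P) → consecutive∉ S component i (∈-preimage⁻ i∈P , ∈-preimage⁻ i+1∈P))
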